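{- Let $0<k<d$ be integers and let $P$ be a simplicial poset of rank $d$ with exactly $d$ atoms ($f_0(P)=d$). Suppose that for each atom $v$ of $P$, $h_i(\mathrm{lk}_P(v))=\binom{d-1}{i}$ if $i\in\{0,k\}$ and $h_i(\mathrm{lk}_P(v))=0$ otherwise. Then $h_i(P)=0$ for $0<i\le k$ and $h_i(P)=(-1)^{i-k+1}\binom{d}{i}$ for $k<i\le d$.
   Context: A simplicial poset is a finite poset with unique minimal element $\hat0$ in which every interval $[\hat0,\tau]$ is a Boolean lattice; $\mathrm{rk}(\tau)$ is the rank of $[\hat0,\tau]$; atoms are elements of rank 1; $f_{i-1}(P)$ is the number of elements of rank $i$. For $P$ of rank $d$, $h_j(P)=\sum_{i=0}^j(-1)^{j-i}\binom{d-i}{d-j}f_{i-1}(P)$. The link of an atom $v$ is $\mathrm{lk}_P(v)=\{\tau\in P:\tau\ge v\}$, a simplicial poset with minimal element $v$; its $h$-numbers are taken with respect to rank $d-1$: $h_j(\mathrm{lk}_P(v))=\sum_{i=0}^j(-1)^{j-i}\binom{d-1-i}{d-1-j}f_{i-1}(\mathrm{lk}_P(v))$, where $f_{i-1}(\mathrm{lk}_P(v))$ is the number of $\tau\ge v$ with $\mathrm{rk}(\tau)-\mathrm{rk}(v)=i$. -}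

module Defs where

open import Data.Nat using (ℕ; zero; suc; _+_; _∸_; _≤_; _<_; _≡ᵇ_)
open import Data.Nat.Combinatorics using (_C_)
open import Data.Bool using (Bool; T; _∧_)
open import Data.Fin using (Fin)
open import Data.Fin.Subset using (Subset; _⊆_)
open import Data.List using (List; length; filterᵇ; map; upTo; foldr)
open import Data.List using (allFin)
open import Data.Integer using (ℤ; +_; -_) renaming (_+_ to _+ℤ_; _*_ to _*ℤ_; _^_ to _^ℤ_)
open import Data.Product using (Σ; _×_; _,_)
open import Relation.Binary.PropositionalEquality using (_≡_)
open import Function.Bundles using (_⇔_)

-- The order is Bool-valued (hence proof-irrelevant and decidable).
-- rk τ is the rank of the interval [0̂,τ]; the field `boolean` says that
-- [0̂,τ] is order-isomorphic to the Boolean lattice of subsets of a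
-- (rk τ)-element set, which forces rk τ to be that rank.
record SimplicialPoset : Set where
  field
    size    : ℕ
    leq     : Fin size → Fin size → Bool
  _≼_ : Fin size → Fin size → Set
  x ≼ y = T (leq x y)
  field
    refl≼    : ∀ x → x ≼ x
    antisym≼ : ∀ x y → x ≼ y → y ≼ x → x ≡ y
    trans≼   : ∀ x y z → x ≼ y → y ≼ z → x ≼ z
    bot      : Fin size
    bot≼     : ∀ x → bot ≼ x
    rk       : Fin size → ℕ
    -- order isomorphism  [0̂,τ] ≅ (Subset (rk τ), ⊆)
    toSub    : (τ : Fin size) → Fin size → Subset (rk τ)
    fromSub  : (τ : Fin size) → Subset (rk τ) → Fin size
    fromSub≼ : ∀ τ s → fromSub τ s ≼ τ
    to∘from  : ∀ τ s → toSub τ (fromSub τ s) ≡ s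
    from∘to  : ∀ τ σ → σ ≼ τ → fromSub τ (toSub τ σ) ≡ σ
    toSub-mono : ∀ τ σ σ' → σ ≼ τ → σ' ≼ τ →
                 (σ ≼ σ') ⇔ (toSub τ σ ⊆ toSub τ σ')

open SimplicialPoset public

HasRank : SimplicialPoset → ℕ → Set
HasRank P d = (∀ τ → rk P τ ≤ d) × Σ (Fin (size P)) (λ τ → rk P τ ≡ d)

IsAtom : (P : SimplicialPoset) → Fin (size P) → Set
IsAtom P v = rk P v ≡ 1

-- f_{i-1}(P) = number of elements of rank i   (fP P i)
fP : SimplicialPoset → ℕ → ℕ
fP P i = length (filterᵇ (λ τ → rk P τ ≡ᵇ i) (allFin (size P)))

-- f_{i-1}(lk_P v) = number of τ ≥ v with rk τ - rk v = i
fLk : (P : SimplicialPoset) → Fin (size P) → ℕ → ℕ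
fLk P v i = length (filterᵇ (λ τ → leq P v τ ∧ (rk P τ ≡ᵇ (i + rk P v))) (allFin (size P)))

sgn : ℕ → ℤ
sgn m = (- (+ 1)) ^ℤ m

sumTo : ℕ → (ℕ → ℤ) → ℤ
sumTo j g = foldr (λ i acc → g i +ℤ acc) (+ 0) (upTo (suc j))

-- h-numbers for a given f-vector (f i = f_{i-1}) w.r.t. rank e:
-- h_j = Σ_{i=0}^j (-1)^{j-i} C(e-i, e-j) f_{i-1}
hFrom : ℕ → (ℕ → ℕ) → ℕ → ℤ
hFrom e f j = sumTo j (λ i → sgn (j ∸ i) *ℤ (+ ((e ∸ i) C (e ∸ j))) *ℤ (+ f i))

hP : SimplicialPoset → ℕ → ℕ → ℤ
hP P d = hFrom d (fP P)

hLk : (P : SimplicialPoset) → ℕ → Fin (size P) → ℕ → ℤ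
hLk P d v = hFrom (d ∸ 1) (fLk P v)

module Submission where

-- Counting incidences between atoms and faces, each face of rank i+1 lying above exactly
-- i+1 atoms, gives Σ_v f_{i-1}(lk v) = (i+1)·f_i(P); in terms of h-numbers this becomes
-- Σ_v h_j(lk v) = (j+1)·h_{j+1}(P) + (d-j)·h_j(P).  As P has d atoms, all with the given link
-- h-vector, the left side is d·C(d-1,j) for j ∈ {0,k} and 0 otherwise, so the relation
-- determines h(P) upwards from h_0(P) = 1: first h_1 = … = h_k = 0, then h_{k+1} = C(d,k+1)
-- by d·C(d-1,k) = (k+1)·C(d,k+1), and beyond that (j+1)·C(d,j+1) = (d-j)·C(d,j) makes the
-- values alternate in sign.

module Binomial where

  open import Data.Nat
  open import Data.Nat.Properties
  open import Data.Nat.Combinatorics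
  open import Relation.Binary.PropositionalEquality
  open ≡-Reasoning

  [1+k]*[1+n]C[1+k]≡[1+n]*nCk : ∀ n k → suc k * (suc n C suc k) ≡ suc n * (n C k)
  [1+k]*[1+n]C[1+k]≡[1+n]*nCk zero    zero    = refl
  [1+k]*[1+n]C[1+k]≡[1+n]*nCk zero    (suc k) = *-zeroʳ (suc (suc k))
  [1+k]*[1+n]C[1+k]≡[1+n]*nCk (suc n) zero    =
    trans (*-identityˡ _) (trans (nC1≡n (suc (suc n))) (sym (*-identityʳ _)))
  [1+k]*[1+n]C[1+k]≡[1+n]*nCk (suc n) (suc k) = begin
    suc (suc k) * (suc (suc n) C suc (suc k))
      ≡⟨ cong (suc (suc k) *_) (sym (nCk+nC[k+1]≡[n+1]C[k+1] (suc n) (suc k))) ⟩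
    suc (suc k) * (suc n C suc k + suc n C suc (suc k))
      ≡⟨ *-distribˡ-+ (suc (suc k)) (suc n C suc k) _ ⟩
    suc n C suc k + suc k * (suc n C suc k) + suc (suc k) * (suc n C suc (suc k))
      ≡⟨ cong₂ (λ x y → suc n C suc k + x + y) ([1+k]*[1+n]C[1+k]≡[1+n]*nCk n k) ([1+k]*[1+n]C[1+k]≡[1+n]*nCk n (suc k)) ⟩
    suc n C suc k + suc n * (n C k) + suc n * (n C suc k)
      ≡⟨ +-assoc (suc n C suc k) _ _ ⟩
    suc n C suc k + (suc n * (n C k) + suc n * (n C suc k))
      ≡⟨ cong (suc n C suc k +_) (sym (*-distribˡ-+ (suc n) (n C k) _)) ⟩
    suc n C suc k + suc n * (n C k + n C suc k)
      ≡⟨ cong (λ x → suc n C suc k + suc n * x) (nCk+nC[k+1]≡[n+1]C[k+1] n k) ⟩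
    suc (suc n) * (suc n C suc k) ∎

  [1+k]*nC[1+k]≡[n∸k]*nCk : ∀ n k → suc k * (n C suc k) ≡ (n ∸ k) * (n C k)
  [1+k]*nC[1+k]≡[n∸k]*nCk n k = begin
    suc k * (n C suc k)                               ≡⟨ m+n∸m≡n (suc k * (n C k)) _ ⟨
    suc k * (n C k) + suc k * (n C suc k) ∸ suc k * (n C k)
      ≡⟨ cong (_∸ suc k * (n C k)) (sym (*-distribˡ-+ (suc k) (n C k) _)) ⟩
    suc k * (n C k + n C suc k) ∸ suc k * (n C k)
      ≡⟨ cong (λ x → suc k * x ∸ suc k * (n C k)) (nCk+nC[k+1]≡[n+1]C[k+1] n k) ⟩
    suc k * (suc n C suc k) ∸ suc k * (n C k)
      ≡⟨ cong (_∸ suc k * (n C k)) ([1+k]*[1+n]C[1+k]≡[1+n]*nCk n k) ⟩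
    suc n * (n C k) ∸ suc k * (n C k)                 ≡⟨ *-distribʳ-∸ (n C k) (suc n) (suc k) ⟨
    (n ∸ k) * (n C k)                                 ∎

module Indicators where

  open import Algebra.Properties.CommutativeMonoid.Sum as Sum using ()
  open import Data.Bool using (Bool; true; false; T)
  open import Data.Empty using (⊥-elim)
  open import Data.Fin using (Fin; zero; suc; _≟_)
  open import Data.List using (length; filterᵇ; tabulate; allFin)
  open import Data.Nat using (ℕ; zero; suc)
  import Data.Nat.Properties as ℕ
  open import Data.Product using (∃; _,_)
  open import Function.Definitions using (Injective)
  open import Relation.Nullary using (does; yes; no)
  open import Relation.Binary.PropositionalEquality
  open ≡-Reasoning

  open Sum ℕ.+-0-commutativeMonoid using (sum; sum-syntax; sum-cong-≗; ∑-comm; sum-replicate-zero)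

  χ : Bool → ℕ
  χ true  = 1
  χ false = 0

  length-filterᵇ-tabulate : ∀ {A : Set} {n} (p : A → Bool) (f : Fin n → A) →
    length (filterᵇ p (tabulate f)) ≡ ∑[ i < n ] χ (p (f i))
  length-filterᵇ-tabulate {n = zero}  p f = refl
  length-filterᵇ-tabulate {n = suc n} p f with p (f zero)
  ... | true  = cong suc (length-filterᵇ-tabulate p (λ i → f (suc i)))
  ... | false = length-filterᵇ-tabulate p (λ i → f (suc i))

  length-filterᵇ-allFin : ∀ n (p : Fin n → Bool) → length (filterᵇ p (allFin n)) ≡ ∑[ i < n ] χ (p i)
  length-filterᵇ-allFin n p = length-filterᵇ-tabulate p (λ i → i)

  ∑-1 : ∀ n → ∑[ i < n ] 1 ≡ n
  ∑-1 zero    = refl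
  ∑-1 (suc n) = cong suc (∑-1 n)

  ∑-χ-≟ : ∀ {n} (y : Fin n) → ∑[ x < n ] χ (does (y ≟ x)) ≡ 1
  ∑-χ-≟ {suc n} zero    = cong suc (∑-0 n)
    where
    ∑-0 : ∀ n → ∑[ x < n ] χ (does (zero {n} ≟ suc x)) ≡ 0
    ∑-0 zero    = refl
    ∑-0 (suc n) = ∑-0 n
  ∑-χ-≟ {suc n} (suc y) = ∑-χ-≟ y

  module _ {n r} (p : Fin n → Bool) (g : Fin r → Fin n)
           (p∘g : ∀ j → T (p (g j))) (g-inj : Injective _≡_ _≡_ g)
           (g-onto : ∀ x → T (p x) → ∃ λ j → g j ≡ x) where

    χ≡∑-fibre : ∀ x → χ (p x) ≡ ∑[ j < r ] χ (does (g j ≟ x))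
    χ≡∑-fibre x with p x in px
    ... | true with g-onto x (subst T (sym px) _)
    ...   | j₀ , gj₀≡x = sym (trans (sum-cong-≗ {r} same-decision) (∑-χ-≟ j₀))
      where
      same-decision : ∀ j → χ (does (g j ≟ x)) ≡ χ (does (j₀ ≟ j))
      same-decision j with g j ≟ x | j₀ ≟ j
      ... | yes _    | yes _    = refl
      ... | no _     | no _     = refl
      ... | yes gj≡x | no j₀≢j  = ⊥-elim (j₀≢j (g-inj (trans gj₀≡x (sym gj≡x))))
      ... | no gj≢x  | yes refl = ⊥-elim (gj≢x gj₀≡x)
    χ≡∑-fibre x | false = sym (trans (sum-cong-≗ {r} term-zero) (sum-replicate-zero r))
      where
      term-zero : ∀ j → χ (does (g j ≟ x)) ≡ 0
      term-zero j with g j ≟ x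
      ... | no _     = refl
      ... | yes refl = ⊥-elim (subst T px (p∘g j))

    ∑-χ-image : ∑[ x < n ] χ (p x) ≡ r
    ∑-χ-image = begin
      ∑[ x < n ] χ (p x)                              ≡⟨ sum-cong-≗ {n} χ≡∑-fibre ⟩
      ∑[ x < n ] ∑[ j < r ] χ (does (g j ≟ x))        ≡⟨ ∑-comm {n} {r} (λ x j → χ (does (g j ≟ x))) ⟩
      ∑[ j < r ] ∑[ x < n ] χ (does (g j ≟ x))        ≡⟨ sum-cong-≗ {r} (λ j → ∑-χ-≟ (g j)) ⟩
      ∑[ j < r ] 1                                    ≡⟨ ∑-1 r ⟩
      r                                               ∎

module HNumbers where

  open import Defs
  open Binomial
  open import Algebra.Properties.CommutativeMonoid.Sum as Sum using ()
  open import Data.Nat as ℕ using (ℕ; zero; suc; _≤_; _<_; _∸_; pred; s≤s)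
  import Data.Nat.Properties as ℕ
  open import Data.Nat.Combinatorics using (_C_; k>n⇒nCk≡0; nCn≡1)
  open import Data.Fin using (Fin; toℕ; inject₁; fromℕ)
  import Data.Fin.Properties as Fin
  open import Data.Integer using (ℤ; +_; -_; _+_; _*_)
  import Data.Integer.Properties as ℤ
  open import Data.Integer.Tactic.RingSolver using (solve-∀)
  open import Data.List using (foldr; applyUpTo)
  open import Relation.Binary.PropositionalEquality
  open ≡-Reasoning

  open Sum ℤ.+-0-commutativeMonoid using (sum; sum-syntax; sum-cong-≗; ∑-distrib-+; ∑-comm; sum-init-last)
  open import Algebra.Properties.Semiring.Sum ℤ.+-*-semiring using (*-distribˡ-sum)
  module ℕΣ = Sum ℕ.+-0-commutativeMonoid

  foldr-applyUpTo≡∑ : ∀ n (f : ℕ → ℕ) (g : ℕ → ℤ) →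
    foldr (λ i acc → g i + acc) (+ 0) (applyUpTo f n) ≡ ∑[ i < n ] g (f (toℕ i))
  foldr-applyUpTo≡∑ zero    f g = refl
  foldr-applyUpTo≡∑ (suc n) f g = cong (_+_ (g (f 0))) (foldr-applyUpTo≡∑ n (λ i → f (suc i)) g)

  sumTo≡∑ : ∀ j g → sumTo j g ≡ ∑[ i < suc j ] g (toℕ i)
  sumTo≡∑ j = foldr-applyUpTo≡∑ (suc j) (λ i → i)

  hCoeff : ℕ → ℕ → ℕ → ℤ
  hCoeff e j i = sgn (j ∸ i) * + ((e ∸ i) C (e ∸ j))

  hTerm : ℕ → (ℕ → ℕ) → ℕ → ℕ → ℤ
  hTerm e f j i = hCoeff e j i * + f i

  hFrom≡∑ : ∀ e f j → hFrom e f j ≡ ∑[ i < suc j ] hTerm e f j (toℕ i)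
  hFrom≡∑ e f j = sumTo≡∑ j (hTerm e f j)

  hFrom-cong : ∀ e j {f g : ℕ → ℕ} → (∀ i → f i ≡ g i) → hFrom e f j ≡ hFrom e g j
  hFrom-cong e j {f} {g} f≗g = begin
    hFrom e f j
      ≡⟨ hFrom≡∑ e f j ⟩
    ∑[ i < suc j ] hTerm e f j (toℕ i)
      ≡⟨ sum-cong-≗ {suc j} (λ i → cong (λ x → hCoeff e j (toℕ i) * + x) (f≗g (toℕ i))) ⟩
    ∑[ i < suc j ] hTerm e g j (toℕ i)
      ≡⟨ hFrom≡∑ e g j ⟨
    hFrom e g j ∎

  hFrom-0 : ∀ e f → hFrom e f 0 ≡ + f 0
  hFrom-0 e f = begin
    sgn 0 * + (e C e) * + f 0 + + 0    ≡⟨ ℤ.+-identityʳ _ ⟩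
    sgn 0 * + (e C e) * + f 0          ≡⟨ cong (λ c → + 1 * + c * + f 0) (nCn≡1 e) ⟩
    + 1 * + 1 * + f 0                  ≡⟨ ℤ.*-identityˡ (+ f 0) ⟩
    + f 0                              ∎

  +-∑ : ∀ {n} (f : Fin n → ℕ) → + (ℕΣ.∑[ i < n ] f i) ≡ ∑[ i < n ] (+ f i)
  +-∑ {zero}  f = refl
  +-∑ {suc n} f = trans (ℤ.pos-+ (f Fin.zero) _) (cong (_+_ (+ f Fin.zero)) (+-∑ (λ i → f (Fin.suc i))))

  hFrom-∑ : ∀ e j {n} (w : Fin n → ℕ) (f : Fin n → ℕ → ℕ) →
    hFrom e (λ i → ℕΣ.∑[ v < n ] (w v ℕ.* f v i)) j ≡ ∑[ v < n ] (+ w v * hFrom e (f v) j)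
  hFrom-∑ e j {n} w f = begin
    hFrom e (λ i → ℕΣ.∑[ v < n ] (w v ℕ.* f v i)) j
      ≡⟨ hFrom≡∑ e (λ i → ℕΣ.∑[ v < n ] (w v ℕ.* f v i)) j ⟩
    ∑[ i < suc j ] (κ i * + ℕΣ.∑[ v < n ] (w v ℕ.* f v (toℕ i)))
      ≡⟨ sum-cong-≗ {suc j} (λ i → cong (κ i *_) (expand (toℕ i))) ⟩
    ∑[ i < suc j ] (κ i * ∑[ v < n ] (wf i v))
      ≡⟨ sum-cong-≗ {suc j} (λ i → *-distribˡ-sum {n} (κ i) (wf i)) ⟩
    ∑[ i < suc j ] ∑[ v < n ] (κ i * wf i v)
      ≡⟨ ∑-comm {suc j} {n} (λ i v → κ i * wf i v) ⟩
    ∑[ v < n ] ∑[ i < suc j ] (κ i * wf i v)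
      ≡⟨ sum-cong-≗ {n} (λ v → sum-cong-≗ {suc j} (λ i → regroup (κ i) (+ w v) (+ f v (toℕ i)))) ⟩
    ∑[ v < n ] ∑[ i < suc j ] (+ w v * hTerm e (f v) j (toℕ i))
      ≡⟨ sum-cong-≗ {n} (λ v → *-distribˡ-sum {suc j} (+ w v) (λ i → hTerm e (f v) j (toℕ i))) ⟨
    ∑[ v < n ] (+ w v * ∑[ i < suc j ] hTerm e (f v) j (toℕ i))
      ≡⟨ sum-cong-≗ {n} (λ v → cong (+ w v *_) (hFrom≡∑ e (f v) j)) ⟨
    ∑[ v < n ] (+ w v * hFrom e (f v) j) ∎
    where
    κ : Fin (suc j) → ℤ
    κ i = hCoeff e j (toℕ i)
    wf : Fin (suc j) → Fin n → ℤ
    wf i v = + w v * + f v (toℕ i)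
    expand : ∀ i → + ℕΣ.∑[ v < n ] (w v ℕ.* f v i) ≡ ∑[ v < n ] (+ w v * + f v i)
    expand i = trans (+-∑ (λ v → w v ℕ.* f v i)) (sum-cong-≗ {n} (λ v → ℤ.pos-* (w v) (f v i)))
    regroup : ∀ k w x → k * (w * x) ≡ w * (k * x)
    regroup = solve-∀

  -- The truncated pred is harmless: for a = 0 both sides vanish, as C(m, m+1) = 0.
  sgn-pred-absorb : ∀ a m →
    + suc m * (sgn (pred a) * + ((a ℕ.+ m) C suc m)) ≡ - (+ a * (sgn a * + ((a ℕ.+ m) C m)))
  sgn-pred-absorb zero    m rewrite k>n⇒nCk≡0 (ℕ.n<1+n m) = ℤ.*-zeroʳ (+ suc m)
  sgn-pred-absorb (suc a) m = begin
    + suc m * (s * + c′)        ≡⟨ ℤ.*-comm (+ suc m) (s * + c′) ⟩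
    s * + c′ * + suc m          ≡⟨ ℤ.*-assoc s (+ c′) (+ suc m) ⟩
    s * (+ c′ * + suc m)        ≡⟨ cong (s *_) (ℤ.pos-* c′ (suc m)) ⟨
    s * + (c′ ℕ.* suc m)        ≡⟨ cong (λ x → s * + x) absorbed ⟩
    s * + (suc a ℕ.* c)         ≡⟨ cong (s *_) (ℤ.pos-* (suc a) c) ⟩
    s * (+ suc a * + c)         ≡⟨ flip s (+ suc a) (+ c) ⟩
    - (+ suc a * (sgn (suc a) * + c)) ∎
    where
    s = sgn a
    c = (suc a ℕ.+ m) C m
    c′ = (suc a ℕ.+ m) C suc m
    absorbed : c′ ℕ.* suc m ≡ suc a ℕ.* c
    absorbed = trans (ℕ.*-comm c′ (suc m))
      (trans ([1+k]*nC[1+k]≡[n∸k]*nCk (suc a ℕ.+ m) m) (cong (ℕ._* c) (ℕ.m+n∸n≡m (suc a) m)))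
    flip : ∀ s x c → s * (x * c) ≡ - (x * (- (+ 1) * s * c))
    flip = solve-∀

  -- The summand identity behind hFrom-weighted, in the coordinates a = j+1-i, m = d-j-1,
  -- where no truncated subtraction occurs.
  hTerm-weighted-core : ∀ i a m (F : ℕ) →
    sgn a * + ((a ℕ.+ m) C m) * + (i ℕ.* F)
      ≡ + (i ℕ.+ a) * (sgn a * + ((a ℕ.+ m) C m) * + F)
        + + suc m * (sgn (pred a) * + ((a ℕ.+ m) C suc m) * + F)
  hTerm-weighted-core i a m F = begin
    X * + (i ℕ.* F)                                  ≡⟨ cong (X *_) (ℤ.pos-* i F) ⟩
    X * (+ i * + F)                                  ≡⟨ cancel X Y (+ i) (+ a) (+ suc m) (+ F) (sgn-pred-absorb a m) ⟩
    (+ i + + a) * (X * + F) + + suc m * (Y * + F)    ≡⟨ cong (λ x → x * (X * + F) + + suc m * (Y * + F)) (ℤ.pos-+ i a) ⟨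
    + (i ℕ.+ a) * (X * + F) + + suc m * (Y * + F)    ∎
    where
    X = sgn a * + ((a ℕ.+ m) C m)
    Y = sgn (pred a) * + ((a ℕ.+ m) C suc m)
    cancel : ∀ X Y I A M F → M * Y ≡ - (A * X) → X * (I * F) ≡ (I + A) * (X * F) + M * (Y * F)
    cancel X Y I A M F MY≡-AX = begin
      X * (I * F)                              ≡⟨ l₁ X I A F ⟩
      (I + A) * (X * F) + - (A * X) * F        ≡⟨ cong (λ z → (I + A) * (X * F) + z * F) MY≡-AX ⟨
      (I + A) * (X * F) + M * Y * F            ≡⟨ cong (_+_ ((I + A) * (X * F))) (ℤ.*-assoc M Y F) ⟩
      (I + A) * (X * F) + M * (Y * F)          ∎
      where
      l₁ : ∀ X I A F → X * (I * F) ≡ (I + A) * (X * F) + - (A * X) * F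
      l₁ = solve-∀

  hTerm-weighted : ∀ {d j i} (F : ℕ → ℕ) → i ≤ suc j → suc j ≤ d →
    hTerm d (λ i → i ℕ.* F i) (suc j) i ≡ + suc j * hTerm d F (suc j) i + + (d ∸ j) * hTerm d F j i
  hTerm-weighted {d} {j} {i} F i≤1+j 1+j≤d = reindex d∸i≡a+m d∸j≡1+m j∸i≡pred-a
    where
    a = suc j ∸ i
    m = d ∸ suc j
    d∸i≡a+m : d ∸ i ≡ a ℕ.+ m
    d∸i≡a+m = begin
      d ∸ i             ≡⟨ cong (_∸ i) (ℕ.m∸n+n≡m 1+j≤d) ⟨
      (m ℕ.+ suc j) ∸ i ≡⟨ ℕ.+-∸-assoc m i≤1+j ⟩
      m ℕ.+ a           ≡⟨ ℕ.+-comm m a ⟩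
      a ℕ.+ m           ∎
    d∸j≡1+m : d ∸ j ≡ suc m
    d∸j≡1+m = ℕ.+-∸-assoc 1 1+j≤d
    j∸i≡pred-a : j ∸ i ≡ pred a
    j∸i≡pred-a = sym (ℕ.pred[m∸n]≡m∸[1+n] (suc j) i)
    reindex : d ∸ i ≡ a ℕ.+ m → d ∸ j ≡ suc m → j ∸ i ≡ pred a →
      hTerm d (λ i → i ℕ.* F i) (suc j) i ≡ + suc j * hTerm d F (suc j) i + + (d ∸ j) * hTerm d F j i
    reindex p q r rewrite p | q | r =
      trans (hTerm-weighted-core i a m (F i)) (cong (λ x → + x * X + + suc m * Y) (ℕ.m+[n∸m]≡n i≤1+j))
      where
      X = sgn a * + ((a ℕ.+ m) C m) * + F i
      Y = sgn (pred a) * + ((a ℕ.+ m) C suc m) * + F i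

  -- The added term i = j+1 vanishes, since C(d-j-1, d-j) = 0.
  hFrom≡∑-extended : ∀ {d} j (F : ℕ → ℕ) → j < d → hFrom d F j ≡ ∑[ i < suc (suc j) ] hTerm d F j (toℕ i)
  hFrom≡∑-extended {d} j F j<d = begin
    hFrom d F j
      ≡⟨ hFrom≡∑ d F j ⟩
    ∑[ i < suc j ] B (toℕ i)
      ≡⟨ sum-cong-≗ {suc j} (λ i → cong B (Fin.toℕ-inject₁ i)) ⟨
    ∑[ i < suc j ] B (toℕ (inject₁ i))
      ≡⟨ ℤ.+-identityʳ _ ⟨
    ∑[ i < suc j ] B (toℕ (inject₁ i)) + + 0
      ≡⟨ cong (_+_ (∑[ i < suc j ] B (toℕ (inject₁ i)))) last≡0 ⟨
    ∑[ i < suc j ] B (toℕ (inject₁ i)) + B (toℕ (fromℕ (suc j)))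
      ≡⟨ sum-init-last (λ i → B (toℕ i)) ⟨
    ∑[ i < suc (suc j) ] B (toℕ i) ∎
    where
    B = hTerm d F j
    last≡0 : B (toℕ (fromℕ (suc j))) ≡ + 0
    last≡0 rewrite Fin.toℕ-fromℕ (suc j) | ℕ.+-∸-assoc 1 j<d | k>n⇒nCk≡0 (ℕ.n<1+n (d ∸ suc j)) =
      trans (cong (_* + F (suc j)) (ℤ.*-zeroʳ (sgn (j ∸ suc j)))) (ℤ.*-zeroˡ (+ F (suc j)))

  hFrom-weighted : ∀ {d j} (F : ℕ → ℕ) → j < d →
    hFrom d (λ i → i ℕ.* F i) (suc j) ≡ + suc j * hFrom d F (suc j) + + (d ∸ j) * hFrom d F j
  hFrom-weighted {d} {j} F j<d = begin
    hFrom d G (suc j)                                       ≡⟨ hFrom≡∑ d G (suc j) ⟩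
    ∑[ i < 2+j ] hTerm d G (suc j) (toℕ i)
      ≡⟨ sum-cong-≗ {2+j} (λ i → hTerm-weighted F (ℕ.≤-pred (Fin.toℕ<n i)) j<d) ⟩
    ∑[ i < 2+j ] (+ suc j * A (toℕ i) + + (d ∸ j) * B (toℕ i))
      ≡⟨ ∑-distrib-+ {2+j} (λ i → + suc j * A (toℕ i)) (λ i → + (d ∸ j) * B (toℕ i)) ⟩
    ∑[ i < 2+j ] (+ suc j * A (toℕ i)) + ∑[ i < 2+j ] (+ (d ∸ j) * B (toℕ i))
      ≡⟨ cong₂ _+_ (*-distribˡ-sum {2+j} (+ suc j) (λ i → A (toℕ i)))
                   (*-distribˡ-sum {2+j} (+ (d ∸ j)) (λ i → B (toℕ i))) ⟨
    + suc j * ∑[ i < 2+j ] A (toℕ i) + + (d ∸ j) * ∑[ i < 2+j ] B (toℕ i)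
      ≡⟨ cong₂ (λ x y → + suc j * x + + (d ∸ j) * y) (hFrom≡∑ d F (suc j)) (hFrom≡∑-extended j F j<d) ⟨
    + suc j * hFrom d F (suc j) + + (d ∸ j) * hFrom d F j    ∎
    where
    2+j = suc (suc j)
    G = λ i → i ℕ.* F i
    A = hTerm d F (suc j)
    B = hTerm d F j

  ∂ : (ℕ → ℕ) → ℕ → ℕ
  ∂ f i = suc i ℕ.* f (suc i)

  -- Reindex i ↦ i+1; the new term i = 0 vanishes because of its weight 0.
  hFrom-∂ : ∀ e j (F : ℕ → ℕ) → hFrom e (∂ F) j ≡ hFrom (suc e) (λ i → i ℕ.* F i) (suc j)
  hFrom-∂ e j F = begin
    hFrom e (∂ F) j
      ≡⟨ hFrom≡∑ e (∂ F) j ⟩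
    ∑[ i < suc j ] hTerm e (∂ F) j (toℕ i)
      ≡⟨ ℤ.+-identityˡ _ ⟨
    + 0 + ∑[ i < suc j ] hTerm e (∂ F) j (toℕ i)
      ≡⟨ cong (_+ ∑[ i < suc j ] hTerm e (∂ F) j (toℕ i)) (ℤ.*-zeroʳ (hCoeff (suc e) (suc j) 0)) ⟨
    ∑[ i < suc (suc j) ] hTerm (suc e) G (suc j) (toℕ i)
      ≡⟨ hFrom≡∑ (suc e) G (suc j) ⟨
    hFrom (suc e) G (suc j) ∎
    where
    G = λ i → i ℕ.* F i

  hFrom-derivative : ∀ e j (F : ℕ → ℕ) → j ≤ e →
    hFrom e (∂ F) j ≡ + suc j * hFrom (suc e) F (suc j) + + (suc e ∸ j) * hFrom (suc e) F j
  hFrom-derivative e j F j≤e = trans (hFrom-∂ e j F) (hFrom-weighted F (s≤s j≤e))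

module AtomIncidence where

  open import Defs using (SimplicialPoset; fP; fLk)
  open Indicators
  open HNumbers using (∂)
  open import Algebra.Properties.CommutativeMonoid.Sum as Sum using ()
  open import Data.Bool using (Bool; true; false; T; _∧_)
  open import Data.Bool.Properties using (T-∧; ∧-zeroʳ; ∧-identityʳ)
  open import Data.Fin using (Fin; zero)
  open import Data.Fin.Subset as Subset using (Subset; ⁅_⁆; _∈_; _⊆_; inside; outside)
  open import Data.Fin.Subset.Properties
  open import Data.Nat using (zero; suc; _*_; _+_; _≤_; _≡ᵇ_; s≤s; z≤n)
  import Data.Nat.Properties as ℕ
  open import Data.Product using (∃; _×_; _,_)
  open import Data.Sum as ⊎ using (_⊎_; inj₁; inj₂)
  open import Data.Vec using ([]; _∷_)
  open import Function.Bundles using (Equivalence)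
  open import Relation.Binary.Definitions using (tri<; tri≈; tri>)
  open import Relation.Nullary using (yes; no; contradiction)
  open import Relation.Binary.PropositionalEquality
  open ≡-Reasoning

  open Sum ℕ.+-0-commutativeMonoid using (sum; sum-syntax; sum-cong-≗; ∑-comm)
  open import Algebra.Properties.Semiring.Sum ℕ.+-*-semiring using (*-distribˡ-sum)

  Subset-0-trivial : ∀ {r} → r ≡ 0 → (s t : Subset r) → s ≡ t
  Subset-0-trivial refl [] [] = refl

  Subset-trivial⇒0 : ∀ {r} → ((s t : Subset r) → s ≡ t) → r ≡ 0
  Subset-trivial⇒0 {zero}  _      = refl
  Subset-trivial⇒0 {suc r} ⊥≡⊤ with () ← ⊥≡⊤ Subset.⊥ Subset.⊤

  Subset-1 : ∀ {r} → r ≡ 1 → (s : Subset r) → s ≡ Subset.⊥ ⊎ s ≡ Subset.⊤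
  Subset-1 refl (outside ∷ []) = inj₁ refl
  Subset-1 refl (inside  ∷ []) = inj₂ refl

  proper-Subset : ∀ {r} → 2 ≤ r → ∃ λ (s : Subset r) → s ≢ Subset.⊥ × s ≢ Subset.⊤
  proper-Subset (s≤s (s≤s z≤n)) = ⁅ zero ⁆ , (λ ()) , λ ()

  ⁅⁆≢⊥ : ∀ {n} (j : Fin n) → ⁅ j ⁆ ≢ Subset.⊥
  ⁅⁆≢⊥ j ⁅j⁆≡⊥ = ∉⊥ (subst (j ∈_) ⁅j⁆≡⊥ (x∈⁅x⁆ j))

  ∈⇒⁅⁆⊆ : ∀ {n} {s : Subset n} {j : Fin n} → j ∈ s → ⁅ j ⁆ ⊆ s
  ∈⇒⁅⁆⊆ {s = s} {j} j∈s x∈⁅j⁆ = subst (_∈ s) (sym (x∈⁅y⁆⇒x≡y j x∈⁅j⁆)) j∈s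

  ⁅⁆-injective : ∀ {n} {i j : Fin n} → ⁅ i ⁆ ≡ ⁅ j ⁆ → i ≡ j
  ⁅⁆-injective {i = i} {j} eq = x∈⁅y⁆⇒x≡y j (subst (i ∈_) eq (x∈⁅x⁆ i))

  ⊆⁅⁆ : ∀ {n} {s : Subset n} (j : Fin n) → s ⊆ ⁅ j ⁆ → s ≡ Subset.⊥ ⊎ s ≡ ⁅ j ⁆
  ⊆⁅⁆ {s = s} j s⊆⁅j⁆ with j ∈? s
  ... | yes j∈s = inj₂ (⊆-antisym s⊆⁅j⁆ (∈⇒⁅⁆⊆ j∈s))
  ... | no  j∉s = inj₁ (Empty-unique λ (x , x∈s) → j∉s (subst (_∈ s) (x∈⁅y⁆⇒x≡y j (s⊆⁅j⁆ x∈s)) x∈s))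

  module _ (P : SimplicialPoset) where

    private module P = SimplicialPoset P
    open P using (_≼_; bot; toSub; fromSub)

    toSub-mono : ∀ {τ σ σ′} → σ ≼ τ → σ′ ≼ τ → σ ≼ σ′ → toSub τ σ ⊆ toSub τ σ′
    toSub-mono σ≼τ σ′≼τ = Equivalence.to (P.toSub-mono _ _ _ σ≼τ σ′≼τ)

    toSub-reflects : ∀ {τ σ σ′} → σ ≼ τ → σ′ ≼ τ → toSub τ σ ⊆ toSub τ σ′ → σ ≼ σ′
    toSub-reflects σ≼τ σ′≼τ = Equivalence.from (P.toSub-mono _ _ _ σ≼τ σ′≼τ)

    toSub-injective : ∀ {τ σ σ′} → σ ≼ τ → σ′ ≼ τ → toSub τ σ ≡ toSub τ σ′ → σ ≡ σ′
    toSub-injective {τ} {σ} {σ′} σ≼τ σ′≼τ eq = begin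
      σ                        ≡⟨ P.from∘to τ σ σ≼τ ⟨
      fromSub τ (toSub τ σ)    ≡⟨ cong (fromSub τ) eq ⟩
      fromSub τ (toSub τ σ′)   ≡⟨ P.from∘to τ σ′ σ′≼τ ⟩
      σ′                       ∎

    fromSub-injective : ∀ τ {s t} → fromSub τ s ≡ fromSub τ t → s ≡ t
    fromSub-injective τ {s} {t} eq = begin
      s                        ≡⟨ P.to∘from τ s ⟨
      toSub τ (fromSub τ s)    ≡⟨ cong (toSub τ) eq ⟩
      toSub τ (fromSub τ t)    ≡⟨ P.to∘from τ t ⟩
      t                        ∎

    ≼bot⇒≡bot : ∀ {x} → x ≼ bot → x ≡ bot
    ≼bot⇒≡bot {x} x≼bot = P.antisym≼ x bot x≼bot (P.bot≼ x)

    toSub-bot : ∀ τ → toSub τ bot ≡ Subset.⊥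
    toSub-bot τ = ⊆-antisym bot⊆⊥ (⊆-min (toSub τ bot))
      where
      bot⊆⊥ : toSub τ bot ⊆ Subset.⊥
      bot⊆⊥ = subst (toSub τ bot ⊆_) (P.to∘from τ Subset.⊥)
        (toSub-mono (P.bot≼ τ) (P.fromSub≼ τ Subset.⊥) (P.bot≼ (fromSub τ Subset.⊥)))

    toSub-self : ∀ τ → toSub τ τ ≡ Subset.⊤
    toSub-self τ = ⊆-antisym (⊆-max (toSub τ τ)) ⊤⊆self
      where
      ⊤⊆self : Subset.⊤ ⊆ toSub τ τ
      ⊤⊆self = subst (_⊆ toSub τ τ) (P.to∘from τ Subset.⊤)
        (toSub-mono (P.fromSub≼ τ Subset.⊤) (P.refl≼ τ) (P.fromSub≼ τ Subset.⊤))

    fromSub≡bot⇒≡⊥ : ∀ τ {s} → fromSub τ s ≡ bot → s ≡ Subset.⊥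
    fromSub≡bot⇒≡⊥ τ {s} eq = trans (sym (P.to∘from τ s)) (trans (cong (toSub τ) eq) (toSub-bot τ))

    rk-bot : P.rk bot ≡ 0
    rk-bot = Subset-trivial⇒0 λ s t →
      fromSub-injective bot (trans (≼bot⇒≡bot (P.fromSub≼ bot s)) (sym (≼bot⇒≡bot (P.fromSub≼ bot t))))

    rk≡0⇒≡bot : ∀ {x} → P.rk x ≡ 0 → x ≡ bot
    rk≡0⇒≡bot {x} rk≡0 = toSub-injective (P.refl≼ x) (P.bot≼ x) (Subset-0-trivial rk≡0 _ _)

    toSub≡⊥⇒≡bot : ∀ {τ x} → x ≼ τ → toSub τ x ≡ Subset.⊥ → x ≡ bot
    toSub≡⊥⇒≡bot {τ} x≼τ eq = toSub-injective x≼τ (P.bot≼ τ) (trans eq (sym (toSub-bot τ)))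

    toSub≡⇒≡fromSub : ∀ {τ x s} → x ≼ τ → toSub τ x ≡ s → x ≡ fromSub τ s
    toSub≡⇒≡fromSub {τ} {s = s} x≼τ eq = toSub-injective x≼τ (P.fromSub≼ τ s) (trans eq (sym (P.to∘from τ s)))

    rk≡1⇒interval : ∀ {σ x} → P.rk σ ≡ 1 → x ≼ σ → x ≡ bot ⊎ x ≡ σ
    rk≡1⇒interval {σ} {x} rk≡1 x≼σ =
      ⊎.map (toSub≡⊥⇒≡bot x≼σ) (λ ≡⊤ → toSub-injective x≼σ (P.refl≼ σ) (trans ≡⊤ (sym (toSub-self σ))))
        (Subset-1 rk≡1 (toSub σ x))

    covers-bot⇒rk≡1 : ∀ {σ} → σ ≢ bot → (∀ {x} → x ≼ σ → x ≡ bot ⊎ x ≡ σ) → P.rk σ ≡ 1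
    covers-bot⇒rk≡1 {σ} σ≢bot interval with ℕ.<-cmp (P.rk σ) 1
    ... | tri< rk<1 _ _ = contradiction (rk≡0⇒≡bot (ℕ.n<1⇒n≡0 rk<1)) σ≢bot
    ... | tri≈ _ rk≡1 _ = rk≡1
    ... | tri> _ _ rk>1 with proper-Subset rk>1
    ...   | s , s≢⊥ , s≢⊤ with interval (P.fromSub≼ σ s)
    ...     | inj₁ ≡bot = contradiction (fromSub≡bot⇒≡⊥ σ ≡bot) s≢⊥
    ...     | inj₂ ≡σ   = contradiction (trans (sym (P.to∘from σ s)) (trans (cong (toSub σ) ≡σ) (toSub-self σ))) s≢⊤

    rk-fromSub-⁅⁆ : ∀ τ (j : Fin (P.rk τ)) → P.rk (fromSub τ ⁅ j ⁆) ≡ 1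
    rk-fromSub-⁅⁆ τ j = covers-bot⇒rk≡1 (λ ≡bot → ⁅⁆≢⊥ j (fromSub≡bot⇒≡⊥ τ ≡bot)) interval
      where
      σ = fromSub τ ⁅ j ⁆
      interval : ∀ {x} → x ≼ σ → x ≡ bot ⊎ x ≡ σ
      interval {x} x≼σ = ⊎.map (toSub≡⊥⇒≡bot x≼τ) (toSub≡⇒≡fromSub x≼τ) (⊆⁅⁆ j x⊆⁅j⁆)
        where
        x≼τ = P.trans≼ x σ τ x≼σ (P.fromSub≼ τ ⁅ j ⁆)
        x⊆⁅j⁆ : toSub τ x ⊆ ⁅ j ⁆
        x⊆⁅j⁆ = subst (toSub τ x ⊆_) (P.to∘from τ ⁅ j ⁆) (toSub-mono x≼τ (P.fromSub≼ τ ⁅ j ⁆) x≼σ)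

    atom≼⇒fromSub-⁅⁆ : ∀ {τ σ} → σ ≼ τ → P.rk σ ≡ 1 → ∃ λ j → fromSub τ ⁅ j ⁆ ≡ σ
    atom≼⇒fromSub-⁅⁆ {τ} {σ} σ≼τ rk≡1 with nonempty? (toSub τ σ)
    ... | no empty = contradiction (trans (sym rk-bot) rk-bot≡1) λ ()
      where
      rk-bot≡1 : P.rk bot ≡ 1
      rk-bot≡1 = subst (λ x → P.rk x ≡ 1) (toSub≡⊥⇒≡bot σ≼τ (Empty-unique empty)) rk≡1
    ... | yes (j , j∈σ) with rk≡1⇒interval rk≡1 y≼σ
      where
      y≼σ : fromSub τ ⁅ j ⁆ ≼ σ
      y≼σ = toSub-reflects (P.fromSub≼ τ ⁅ j ⁆) σ≼τ
              (subst (_⊆ toSub τ σ) (sym (P.to∘from τ ⁅ j ⁆)) (∈⇒⁅⁆⊆ j∈σ))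
    ...   | inj₁ ≡bot = contradiction (fromSub≡bot⇒≡⊥ τ ≡bot) (⁅⁆≢⊥ j)
    ...   | inj₂ ≡σ   = j , ≡σ

    atoms-below : ∀ τ → ∑[ v < P.size ] χ (P.leq v τ ∧ (P.rk v ≡ᵇ 1)) ≡ P.rk τ
    atoms-below τ = ∑-χ-image (λ v → P.leq v τ ∧ (P.rk v ≡ᵇ 1)) (λ j → fromSub τ ⁅ j ⁆)
      (λ j → Equivalence.from T-∧ (P.fromSub≼ τ ⁅ j ⁆ , ℕ.≡⇒≡ᵇ _ 1 (rk-fromSub-⁅⁆ τ j)))
      (λ eq → ⁅⁆-injective (fromSub-injective τ eq))
      (λ v v-atom≼τ → let v≼τ , rk≡1 = Equivalence.to T-∧ v-atom≼τ
                      in atom≼⇒fromSub-⁅⁆ v≼τ (ℕ.≡ᵇ⇒≡ _ 1 rk≡1))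

    fP-0 : fP P 0 ≡ 1
    fP-0 = trans (length-filterᵇ-allFin P.size (λ τ → P.rk τ ≡ᵇ 0))
      (∑-χ-image (λ τ → P.rk τ ≡ᵇ 0) (λ _ → bot) (λ _ → ℕ.≡⇒≡ᵇ _ 0 rk-bot) (λ { {zero} {zero} _ → refl })
        (λ x rk≡0 → zero , sym (rk≡0⇒≡bot (ℕ.≡ᵇ⇒≡ _ 0 rk≡0))))

    χ-incidence : ∀ i v τ →
      χ (P.rk v ≡ᵇ 1) * χ (P.leq v τ ∧ (P.rk τ ≡ᵇ i + P.rk v))
        ≡ χ (P.rk τ ≡ᵇ suc i) * χ (P.leq v τ ∧ (P.rk v ≡ᵇ 1))
    χ-incidence i v τ with P.rk v ≡ᵇ 1 in rk≡ᵇ1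
    ... | false rewrite ∧-zeroʳ (P.leq v τ) = sym (ℕ.*-zeroʳ (χ (P.rk τ ≡ᵇ suc i)))
    ... | true rewrite ℕ.≡ᵇ⇒≡ (P.rk v) 1 (subst T (sym rk≡ᵇ1) _) | ℕ.+-comm i 1
                     | ∧-identityʳ (P.leq v τ) with P.leq v τ | P.rk τ ≡ᵇ suc i
    ...   | true  | true  = refl
    ...   | true  | false = refl
    ...   | false | true  = refl
    ...   | false | false = refl

    ∑-atoms-fLk : ∀ i → ∑[ v < P.size ] (χ (P.rk v ≡ᵇ 1) * fLk P v i) ≡ ∂ (fP P) i
    ∑-atoms-fLk i = begin
      ∑[ v < n ] (χ (atom? v) * fLk P v i)
        ≡⟨ sum-cong-≗ {n} (λ v → cong (χ (atom? v) *_) (length-filterᵇ-allFin n (inLink? v))) ⟩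
      ∑[ v < n ] (χ (atom? v) * ∑[ τ < n ] χ (inLink? v τ))
        ≡⟨ sum-cong-≗ {n} (λ v → *-distribˡ-sum {n} (χ (atom? v)) (λ τ → χ (inLink? v τ))) ⟩
      ∑[ v < n ] ∑[ τ < n ] (χ (atom? v) * χ (inLink? v τ))
        ≡⟨ sum-cong-≗ {n} (λ v → sum-cong-≗ {n} (χ-incidence i v)) ⟩
      ∑[ v < n ] ∑[ τ < n ] (χ (rank? τ) * χ (atomBelow? τ v))
        ≡⟨ ∑-comm {n} {n} (λ v τ → χ (rank? τ) * χ (atomBelow? τ v)) ⟩
      ∑[ τ < n ] ∑[ v < n ] (χ (rank? τ) * χ (atomBelow? τ v))
        ≡⟨ sum-cong-≗ {n} (λ τ → *-distribˡ-sum {n} (χ (rank? τ)) (λ v → χ (atomBelow? τ v))) ⟨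
      ∑[ τ < n ] (χ (rank? τ) * ∑[ v < n ] χ (atomBelow? τ v))
        ≡⟨ sum-cong-≗ {n} (λ τ → cong (χ (rank? τ) *_) (atoms-below τ)) ⟩
      ∑[ τ < n ] (χ (rank? τ) * P.rk τ)
        ≡⟨ sum-cong-≗ {n} χ-rank ⟩
      ∑[ τ < n ] (suc i * χ (rank? τ))
        ≡⟨ *-distribˡ-sum {n} (suc i) (λ τ → χ (rank? τ)) ⟨
      suc i * ∑[ τ < n ] χ (rank? τ)
        ≡⟨ cong (suc i *_) (length-filterᵇ-allFin n rank?) ⟨
      suc i * fP P (suc i) ∎
      where
      n = P.size
      atom? : Fin n → Bool
      atom? v = P.rk v ≡ᵇ 1
      rank? : Fin n → Bool
      rank? τ = P.rk τ ≡ᵇ suc i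
      inLink? : Fin n → Fin n → Bool
      inLink? v τ = P.leq v τ ∧ (P.rk τ ≡ᵇ i + P.rk v)
      atomBelow? : Fin n → Fin n → Bool
      atomBelow? τ v = P.leq v τ ∧ atom? v
      χ-rank : ∀ τ → χ (rank? τ) * P.rk τ ≡ suc i * χ (rank? τ)
      χ-rank τ with rank? τ in rank≡
      ... | true  = trans (ℕ.*-identityˡ (P.rk τ))
                      (trans (ℕ.≡ᵇ⇒≡ (P.rk τ) (suc i) (subst T (sym rank≡) _)) (sym (ℕ.*-identityʳ (suc i))))
      ... | false = sym (ℕ.*-zeroʳ (suc i))

module AtomLinks where

  open import Defs
  open Indicators
  open HNumbers
  open AtomIncidence
  open import Algebra.Properties.CommutativeMonoid.Sum as Sum using ()
  open import Data.Bool using (Bool; true; false; T)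
  open import Data.Fin using (Fin)
  open import Data.Nat as ℕ using (ℕ; suc; _≤_; _∸_; _≡ᵇ_)
  import Data.Nat.Properties as ℕ
  open import Data.Integer using (ℤ; +_; _+_; _*_)
  import Data.Integer.Properties as ℤ
  open import Relation.Binary.PropositionalEquality
  open ≡-Reasoning
  open Sum ℤ.+-0-commutativeMonoid using (sum; sum-syntax; sum-cong-≗)
  open import Algebra.Properties.Semiring.Sum ℤ.+-*-semiring using (*-distribʳ-sum)

  module _ (P : SimplicialPoset) where

    atomLinkSum : ℕ → ℕ → ℤ
    atomLinkSum d j = ∑[ v < size P ] (+ χ (rk P v ≡ᵇ 1) * hLk P d v j)

    atomLinkSum-recurrence : ∀ e j → j ≤ e →
      atomLinkSum (suc e) j ≡ + suc j * hP P (suc e) (suc j) + + (suc e ∸ j) * hP P (suc e) j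
    atomLinkSum-recurrence e j j≤e = begin
      ∑[ v < size P ] (+ χ (rk P v ≡ᵇ 1) * hFrom e (fLk P v) j)
        ≡⟨ hFrom-∑ e j (λ v → χ (rk P v ≡ᵇ 1)) (fLk P) ⟨
      hFrom e (λ i → ℕΣ.∑[ v < size P ] (χ (rk P v ≡ᵇ 1) ℕ.* fLk P v i)) j
        ≡⟨ hFrom-cong e j (∑-atoms-fLk P) ⟩
      hFrom e (∂ (fP P)) j
        ≡⟨ hFrom-derivative e j (fP P) j≤e ⟩
      + suc j * hP P (suc e) (suc j) + + (suc e ∸ j) * hP P (suc e) j ∎

    atomLinkSum-const : ∀ {d} j {c} → fP P 1 ≡ d → (∀ v → IsAtom P v → hLk P d v j ≡ c) → atomLinkSum d j ≡ + d * c
    atomLinkSum-const {d} j {c} fP₁≡d link≡c = begin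
      ∑[ v < size P ] (+ χ (atom? v) * hLk P d v j)
        ≡⟨ sum-cong-≗ {size P} atom-term ⟩
      ∑[ v < size P ] (+ χ (atom? v) * c)
        ≡⟨ *-distribʳ-sum {size P} c (λ v → + χ (atom? v)) ⟨
      ∑[ v < size P ] (+ χ (atom? v)) * c
        ≡⟨ cong (_* c) (+-∑ (λ v → χ (atom? v))) ⟨
      + ℕΣ.∑[ v < size P ] χ (atom? v) * c
        ≡⟨ cong (λ n → + n * c) (length-filterᵇ-allFin (size P) atom?) ⟨
      + fP P 1 * c
        ≡⟨ cong (λ n → + n * c) fP₁≡d ⟩
      + d * c ∎
      where
      atom? : Fin (size P) → Bool
      atom? v = rk P v ≡ᵇ 1
      atom-term : ∀ v → + χ (atom? v) * hLk P d v j ≡ + χ (atom? v) * c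
      atom-term v with atom? v in is-atom
      ... | true  = cong (+ 1 *_) (link≡c v (ℕ.≡ᵇ⇒≡ (rk P v) 1 (subst T (sym is-atom) _)))
      ... | false = refl

module HRecurrence where

  open import Defs using (sgn)
  open Binomial
  open import Algebra.Bundles using (AbelianGroup)
  open import Data.Nat as ℕ using (ℕ; zero; suc; _≤_; _<_; _∸_; s≤s; z≤n)
  import Data.Nat.Properties as ℕ
  open import Data.Nat.Combinatorics using (_C_)
  open import Data.Integer using (ℤ; +_; -_; _+_; _*_)
  import Data.Integer.Properties as ℤ
  open import Data.Integer.Tactic.RingSolver using (solve-∀)
  open import Data.Sum using (inj₁; inj₂)
  open import Relation.Binary.PropositionalEquality
  open ≡-Reasoning
  open import Algebra.Properties.Group (AbelianGroup.group ℤ.+-0-abelianGroup) using (∙-cancelʳ)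

  module Solution {e k : ℕ} (0<k : 0 < k) (k≤e : k ≤ e) (h Σlk : ℕ → ℤ)
           (h-0 : h 0 ≡ + 1)
           (Σlk-rec : ∀ j → j ≤ e → Σlk j ≡ + suc j * h (suc j) + + (suc e ∸ j) * h j)
           (Σlk-0 : Σlk 0 ≡ + suc e * + 1)
           (Σlk-k : Σlk k ≡ + suc e * + (e C k))
           (Σlk-gap : ∀ j → 0 < j → j ≢ k → j ≤ e → Σlk j ≡ + 0) where

    private
      d = suc e

    h-next : ∀ j → j ≤ e → (x : ℤ) → Σlk j ≡ + suc j * x + + (d ∸ j) * h j → h (suc j) ≡ x
    h-next j j≤e x eq = ℤ.*-cancelˡ-≡ (+ suc j) (h (suc j)) x
      (∙-cancelʳ (+ (d ∸ j) * h j) _ _ (trans (sym (Σlk-rec j j≤e)) eq))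

    h-low : ∀ i → 0 < i → i ≤ k → h i ≡ + 0
    h-low (suc zero) _ _ = h-next 0 z≤n (+ 0) (begin
      Σlk 0                      ≡⟨ Σlk-0 ⟩
      + d * + 1                  ≡⟨ ℤ.+-identityˡ _ ⟨
      + 0 + + d * + 1            ≡⟨ cong (λ x → + 0 + + d * x) h-0 ⟨
      + 1 * + 0 + + d * h 0      ∎)
    h-low (suc (suc i)) _ 2+i≤k = h-next j j≤e (+ 0) (begin
      Σlk j
        ≡⟨ Σlk-gap j (s≤s z≤n) (ℕ.<⇒≢ 2+i≤k) j≤e ⟩
      + 0
        ≡⟨ cong₂ _+_ (ℤ.*-zeroʳ (+ suc j)) (ℤ.*-zeroʳ (+ (d ∸ j))) ⟨
      + suc j * + 0 + + (d ∸ j) * + 0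
        ≡⟨ cong (λ x → + suc j * + 0 + + (d ∸ j) * x) (h-low (suc i) (s≤s z≤n) (ℕ.<⇒≤ 2+i≤k)) ⟨
      + suc j * + 0 + + (d ∸ j) * h j ∎)
      where
      j = suc i
      j≤e = ℕ.≤-trans (ℕ.<⇒≤ 2+i≤k) k≤e

    h-high : ∀ i → k < i → i ≤ d → h i ≡ sgn ((i ∸ k) ℕ.+ 1) * + (d C i)
    h-high (suc j) k<1+j (s≤s j≤e) with ℕ.m≤n⇒m<n∨m≡n (ℕ.≤-pred k<1+j)
    ... | inj₂ refl rewrite ℕ.m+n∸n≡m 1 k = h-next k k≤e _ (begin
      Σlk k                                 ≡⟨ Σlk-k ⟩
      + d * + (e C k)                       ≡⟨ ℤ.pos-* d (e C k) ⟨
      + (d ℕ.* (e C k))                     ≡⟨ cong +_ ([1+k]*[1+n]C[1+k]≡[1+n]*nCk e k) ⟨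
      + (suc k ℕ.* (d C suc k))             ≡⟨ ℤ.pos-* (suc k) (d C suc k) ⟩
      + suc k * + (d C suc k)               ≡⟨ cong (λ x → + suc k * x) (ℤ.*-identityˡ _) ⟨
      X                                     ≡⟨ ℤ.+-identityʳ X ⟨
      X + + 0                               ≡⟨ cong (_+_ X) (ℤ.*-zeroʳ (+ (d ∸ k))) ⟨
      X + + (d ∸ k) * + 0                   ≡⟨ cong (λ x → X + + (d ∸ k) * x) (h-low k 0<k ℕ.≤-refl) ⟨
      X + + (d ∸ k) * h k                   ∎)
      where
      X = + suc k * (sgn 2 * + (d C suc k))
    ... | inj₁ k<j rewrite ℕ.+-∸-assoc 1 (ℕ.<⇒≤ k<j) = h-next j j≤e _ (begin
      Σlk j
        ≡⟨ Σlk-gap j (ℕ.≤-<-trans z≤n k<j) (ℕ.>⇒≢ k<j) j≤e ⟩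
      + 0
        ≡⟨ opposite-terms σ (+ suc j) (+ (d C suc j)) (+ (d ∸ j)) (+ (d C j)) absorb ⟨
      + suc j * (- (+ 1) * σ * + (d C suc j)) + + (d ∸ j) * (σ * + (d C j))
        ≡⟨ cong (λ x → + suc j * (- (+ 1) * σ * + (d C suc j)) + + (d ∸ j) * x) (h-high j k<j (ℕ.m≤n⇒m≤1+n j≤e)) ⟨
      + suc j * (- (+ 1) * σ * + (d C suc j)) + + (d ∸ j) * h j ∎)
      where
      σ = sgn ((j ∸ k) ℕ.+ 1)
      absorb : + suc j * + (d C suc j) ≡ + (d ∸ j) * + (d C j)
      absorb = trans (sym (ℤ.pos-* (suc j) _)) (trans (cong +_ ([1+k]*nC[1+k]≡[n∸k]*nCk d j)) (ℤ.pos-* (d ∸ j) _))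
      opposite-terms : ∀ σ a x b y → a * x ≡ b * y → a * (- (+ 1) * σ * x) + b * (σ * y) ≡ + 0
      opposite-terms σ a x b y ax≡by = begin
        a * (- (+ 1) * σ * x) + b * (σ * y)   ≡⟨ regroup σ a x b y ⟩
        - (σ * (a * x)) + σ * (b * y)         ≡⟨ cong (λ z → - (σ * z) + σ * (b * y)) ax≡by ⟩
        - (σ * (b * y)) + σ * (b * y)         ≡⟨ ℤ.+-inverseˡ (σ * (b * y)) ⟩
        + 0                                   ∎
        where
        regroup : ∀ σ a x b y → a * (- (+ 1) * σ * x) + b * (σ * y) ≡ - (σ * (a * x)) + σ * (b * y)
        regroup = solve-∀

open import Defs
open import Data.Nat using (ℕ; _≤_; _<_; _∸_; _+_)
open import Data.Nat.Combinatorics using (_C_)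
open import Data.Fin using (Fin)
open import Data.Integer using (ℤ; +_) renaming (_*_ to _*ℤ_)
open import Data.Sum using (_⊎_)
open import Data.Product using (_×_)
open import Relation.Binary.PropositionalEquality using (_≡_; _≢_)

open import Data.Nat using (suc; s≤s; z≤n)
import Data.Nat.Properties as ℕ
import Data.Integer.Properties as ℤ
open import Data.Product using (_,_; proj₁; proj₂)
open import Data.Sum using (inj₁; inj₂)
open import Relation.Binary.PropositionalEquality using (refl; trans; cong)
open HNumbers using (hFrom-0)
open AtomIncidence using (fP-0)
open AtomLinks

lemma3p2 : (k d : ℕ) → 0 < k → k < d →
    (P : SimplicialPoset) → HasRank P d → fP P 1 ≡ d →
    (∀ v → IsAtom P v → ∀ i → i ≤ d ∸ 1 →
      ((i ≡ 0 ⊎ i ≡ k) → hLk P d v i ≡ + ((d ∸ 1) C i)) ×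
      ((i ≢ 0 × i ≢ k) → hLk P d v i ≡ + 0)) →
    (∀ i → 0 < i → i ≤ k → hP P d i ≡ + 0) ×
    (∀ i → k < i → i ≤ d → hP P d i ≡ sgn ((i ∸ k) + 1) *ℤ (+ (d C i)))
lemma3p2 k (suc e) 0<k (s≤s k≤e) P _ fP₁≡d link-h = h-low , h-high
  where
  open HRecurrence.Solution 0<k k≤e (hP P (suc e)) (atomLinkSum P (suc e))
    (trans (hFrom-0 (suc e) (fP P)) (cong +_ (fP-0 P)))
    (atomLinkSum-recurrence P e)
    (atomLinkSum-const P 0 fP₁≡d λ v atom → proj₁ (link-h v atom 0 z≤n) (inj₁ refl))
    (atomLinkSum-const P k fP₁≡d λ v atom → proj₁ (link-h v atom k k≤e) (inj₂ refl))
    (λ j 0<j j≢k j≤e →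
      trans (atomLinkSum-const P j fP₁≡d λ v atom → proj₂ (link-h v atom j j≤e) (ℕ.>⇒≢ 0<j , j≢k))
            (ℤ.*-zeroʳ (+ suc e)))
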